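{- For $k \ge 0$ let $n = 2^k$ and let $D_n$ be the $n\times n$ Boolean matrix with rows and columns indexed by $0,1,\dots,2^k-1$, whose entry $(i,j)$ equals $1$ if and only if the binary expansions of $i$ and $j$ have no common $1$ (i.e., the corresponding subsets of $\{1,\dots,k\}$ are disjoint), and $0$ otherwise. Then $\mathsf{OR_2}(D_n) \le n^{\log_2(9/4)} \cdot \mathrm{polylog}(n)$; that is, there is a constant $c$ such that $\mathsf{OR_2}(D_n) \le n^{\log_2(9/4)} (\log_2 n + 2)^c$ for all $n = 2^k$.
   Context: A rectifier network with $m$ inputs and $n$ outputs is a tuple $(V,E,\mathsf{in},\mathsf{out})$ where $(V,E)$ is a directed acyclic graph, and $\mathsf{in}\colon\{1,\dots,n\}\to V$ and $\mathsf{out}\colon\{1,\dots,m\}\to V$ are injective maps whose images consist only of sources (respectively, only of sinks) of the graph. Its size is $|E|$. It expresses the Boolean $m\times n$ matrix $M$ with $M_{ij}=1$ iff there is a directed path from $\mathsf{in}(j)$ to $\mathsf{out}(i)$. It has depth $2$ if all maximal paths have exactly $2$ edges. For a Boolean matrix $A$, $\mathsf{OR_2}(A)$ is the smallest size of a depth-$2$ rectifier network expressing $A$ (equivalently, the minimum of $\sum(|R|+|C|)$ over all collections of all-$1$ submatrices $R\times C$ of $A$ whose union covers all $1$-entries of $A$). -}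

module Defs where

open import Data.Nat using (ℕ; zero; suc; _+_; _*_; _^_; _≤_; _/_; _%_; _≡ᵇ_)
open import Data.Bool using (Bool; true; false; _∧_; not)
open import Data.Fin using (Fin; toℕ)
open import Data.Fin.Subset using (Subset; _∈_; ∣_∣)
open import Data.List using (List; map)
open import Data.Nat.ListAction using (sum)
open import Data.List.Relation.Unary.Any using (Any)
open import Data.List.Relation.Unary.All using (All)
open import Data.Product using (_×_; _,_; Σ; ∃)
open import Relation.Binary.PropositionalEquality using (_≡_)

BoolMatrix : ℕ → ℕ → Set
BoolMatrix m n = Fin m → Fin n → Bool

Rect : ℕ → ℕ → Set
Rect m n = Subset m × Subset n

AllOnes : ∀ {m n} → BoolMatrix m n → Rect m n → Set
AllOnes A (R , C) = ∀ i j → i ∈ R → j ∈ C → A i j ≡ true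

InRect : ∀ {m n} → Fin m → Fin n → Rect m n → Set
InRect i j (R , C) = (i ∈ R) × (j ∈ C)

-- Cost |R| + |C| of one rectangle (= edges through its middle node).
rectCost : ∀ {m n} → Rect m n → ℕ
rectCost (R , C) = ∣ R ∣ + ∣ C ∣

record Cover {m n : ℕ} (A : BoolMatrix m n) : Set where
  field
    rects   : List (Rect m n)
    allOnes : All (AllOnes A) rects
    covers  : ∀ i j → A i j ≡ true → Any (InRect i j) rects

coverCost : ∀ {m n} {A : BoolMatrix m n} → Cover A → ℕ
coverCost cov = sum (map rectCost (Cover.rects cov))

-- OR₂(A) is the minimum cover cost; "OR₂(A) * d ≤ b" holds iff some
-- cover has cost s with s * d ≤ b.
OR₂-scaled≤ : ∀ {m n} → BoolMatrix m n → ℕ → ℕ → Set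
OR₂-scaled≤ A d b = Σ (Cover A) λ cov → coverCost cov * d ≤ b

bit : ℕ → ℕ → Bool
bit i zero    = i % 2 ≡ᵇ 1
bit i (suc t) = bit (i / 2) t

disjointᵇ : ℕ → ℕ → ℕ → Bool
disjointᵇ zero    i j = true
disjointᵇ (suc k) i j = not (bit i k ∧ bit j k) ∧ disjointᵇ k i j

D : (k : ℕ) → BoolMatrix (2 ^ k) (2 ^ k)
D k i j = disjointᵇ k (toℕ i) (toℕ j)

-- Index the rows and columns of D_n by subsets of {0, …, k − 1} (the bits of the index), so
-- that the 1-entries are the disjoint pairs (r, s).  Group them into (k + 1)² classes by
-- (∣ r ∣, ∣ s ∣) = (a, b), and put f = k − a − b and g = ⌈f/2⌉.  Every set U of size a + g gives
-- the all-ones rectangle (a-subsets of U) × (b-subsets of ∁ U), of cost C(a + g, a) + C(k − a − g, b),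
-- and each pair of the class lies in exactly C(f, g) ≥ 2^f / (f + 1) of these C(k, a + g) rectangles.
-- Averaging then lets a greedy choice cover the class with (C(k, a + g) / C(f, g) + 1)(2k + 1)
-- rectangles, because (1 − 1/q)^q ≤ 1/2 and the class has fewer than 2^(2k+1) pairs.  Comparing
-- with the terms C(k, a + g) C(a + g, a) 4^a 1^g 4^(k−a−g) of (4 + 1 + 4)^k bounds the cost of a
-- class by O(k (9/4)^k).

module Submission where

open import Algebra.Bundles using (CommutativeMonoid)
open import Data.Bool using (Bool; true; false; not; _∧_; if_then_else_; T)
open import Data.Bool.Properties using (∧-zeroʳ; ∧-comm; ∧-assoc; ∧-commutativeMonoid; T-≡; T-not-≡; T-∧)
open import Data.Empty using (⊥; ⊥-elim)
open import Data.Fin using (Fin; toℕ)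
open import Data.Fin.Properties using (toℕ<n)
open import Data.Fin.Subset using (Subset; ∁; ∣_∣; _─_; _⊆_) renaming (⊥ to ∅; ⊤ to ⊤ₛ; _∈_ to _∈ₛ_)
open import Data.Fin.Subset.Properties
  using (_⊆?_; ⊆-trans; p⊆q⇒∣p∣≤∣q∣; ⊥⊆; ⊆⊤; ∣⊥∣≡0; ∣⊤∣≡n; p─⊥≡p; ∣∁p∣≡n∸∣p∣; ∣p∣≤n)
open import Data.List
  using (List; []; _∷_; length; map; _++_; filterᵇ; concatMap; cartesianProduct; upTo; applyUpTo; [_]; _∷ʳ_)
open import Data.List.Properties
  using (map-++; map-∘; map-cong; length-++; length-map; upTo-∷ʳ; map-upTo; length-upTo; length-filter)
open import Data.List.Membership.Propositional using (_∈_; lose)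
open import Data.List.Membership.Propositional.Properties
  using (∈-filter⁺; ∈-filter⁻; ∈-length; ∈-map⁺; ∈-upTo⁺; ∈-cartesianProduct⁺)
open import Data.List.Relation.Unary.All using (All; []; _∷_)
import Data.List.Relation.Unary.All as All
import Data.List.Relation.Unary.All.Properties as All
open import Data.List.Relation.Unary.Any using (Any; here; there)
import Data.List.Relation.Unary.Any as Any
import Data.List.Relation.Unary.Any.Properties as Any
open import Data.Nat
open import Data.Nat.Combinatorics using (_C_; nCk+nC[k+1]≡[n+1]C[k+1]; nCk≡nC[n∸k]; nCn≡1; nC1≡n)
open import Data.Nat.DivMod
  using (_/_; _%_; m*n%n≡0; m*n/n≡m; [m+kn]%n≡m%n; +-distrib-/; m≡m%n+[m/n]*n; m%n<n; m/n*n≤m)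
open import Data.Nat.ListAction using (sum)
open import Data.Nat.ListAction.Properties using (sum-++)
open import Data.Nat.Properties
open import Data.Nat.Tactic.RingSolver using (solve-∀)
open import Data.Product using (∃; ∃-syntax; _×_; _,_; proj₁; proj₂)
open import Data.Sum using (_⊎_; inj₁; inj₂)
open import Data.Vec using ([]; _∷_; tabulate)
open import Data.Vec.Properties using (lookup∘tabulate; lookup⇒[]=; []=⇒lookup)
open import Function using (_∘_; Equivalence)
open import Relation.Binary.PropositionalEquality
  using (_≡_; _≢_; refl; sym; trans; cong; cong₂; subst; module ≡-Reasoning)
open import Relation.Nullary using (yes; no)
open import Relation.Nullary.Decidable using (T?; does; dec-true; dec-false)
open import Algebra.Properties.CommutativeSemigroup +-commutativeSemigroup
  using () renaming (interchange to +-interchange)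
open import Algebra.Properties.CommutativeSemigroup *-commutativeSemigroup
  using (x∙yz≈y∙xz) renaming (interchange to *-interchange)
open import Algebra.Properties.CommutativeSemigroup (CommutativeMonoid.commutativeSemigroup ∧-commutativeMonoid)
  using () renaming (x∙yz≈y∙xz to ∧-x∙yz≈y∙xz)

open import Defs

private variable A B : Set

-- Binomial coefficients

pascal : ∀ n k → suc n C suc k ≡ n C k + n C suc k
pascal n k = sym (nCk+nC[k+1]≡[n+1]C[k+1] n k)

C-pos : ∀ p m → 1 ≤ (p + m) C p
C-pos zero    m = ≤-refl
C-pos (suc p) m = ≤-trans (C-pos p m) (≤-trans (m≤m+n _ _) (≤-reflexive (sym (pascal (p + m) p))))

C-sym : ∀ m n → (m + n) C m ≡ (n + m) C n
C-sym m n = begin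
  (m + n) C m              ≡⟨ nCk≡nC[n∸k] (m≤m+n m n) ⟩
  (m + n) C ((m + n) ∸ m)  ≡⟨ cong ((m + n) C_) (m+n∸m≡n m n) ⟩
  (m + n) C n              ≡⟨ cong (_C n) (+-comm m n) ⟩
  (n + m) C n              ∎
  where open ≡-Reasoning

binomial-term≤ : ∀ x y p m → ((p + m) C p) * (x ^ p * y ^ m) ≤ (x + y) ^ (p + m)
binomial-term≤ x y zero m = begin
  1 * (1 * y ^ m) ≡⟨ trans (*-identityˡ _) (*-identityˡ _) ⟩
  y ^ m           ≤⟨ ^-monoˡ-≤ m (m≤n+m y x) ⟩
  (x + y) ^ m     ∎
  where open ≤-Reasoning
binomial-term≤ x y (suc p) zero = begin
  ((suc p + 0) C suc p) * (x ^ suc p * 1) ≡⟨ cong₂ _*_ C≡1 (*-identityʳ _) ⟩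
  1 * x ^ suc p                         ≡⟨ *-identityˡ _ ⟩
  x ^ suc p                             ≤⟨ ^-monoˡ-≤ (suc p) (m≤m+n x y) ⟩
  (x + y) ^ suc p                       ≡⟨ cong ((x + y) ^_) (sym (+-identityʳ (suc p))) ⟩
  (x + y) ^ (suc p + 0)                 ∎
  where
  open ≤-Reasoning
  C≡1 : (suc p + 0) C suc p ≡ 1
  C≡1 = trans (cong (_C suc p) (+-identityʳ (suc p))) (nCn≡1 (suc p))
binomial-term≤ x y (suc p) (suc m) = begin
  (suc n C suc p) * (x ^ suc p * y ^ suc m)
    ≡⟨ cong (_* (x ^ suc p * y ^ suc m)) (pascal n p) ⟩
  (n C p + n C suc p) * (x * x ^ p * (y * y ^ m))
    ≡⟨ split (n C p) (n C suc p) x y (x ^ p) (y ^ m) ⟩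
  x * ((n C p) * (x ^ p * y ^ suc m)) + y * ((n C suc p) * (x ^ suc p * y ^ m))
    ≤⟨ +-mono-≤ (*-monoʳ-≤ x (binomial-term≤ x y p (suc m))) (*-monoʳ-≤ y second) ⟩
  x * (x + y) ^ n + y * (x + y) ^ n
    ≡⟨ sym (*-distribʳ-+ _ x y) ⟩
  (x + y) ^ suc n ∎
  where
  open ≤-Reasoning
  n : ℕ
  n = p + suc m
  split : ∀ A B x y xp ym → (A + B) * (x * xp * (y * ym)) ≡ x * (A * (xp * (y * ym))) + y * (B * (x * xp * ym))
  split = solve-∀
  second : (n C suc p) * (x ^ suc p * y ^ m) ≤ (x + y) ^ n
  second rewrite +-suc p m = binomial-term≤ x y (suc p) m

C≤2^ : ∀ p m → (p + m) C p ≤ 2 ^ (p + m)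
C≤2^ p m = begin
  (p + m) C p                    ≡⟨ sym (*-identityʳ _) ⟩
  ((p + m) C p) * (1 * 1)          ≡⟨ cong (((p + m) C p) *_) (sym (cong₂ _*_ (^-zeroˡ p) (^-zeroˡ m))) ⟩
  ((p + m) C p) * (1 ^ p * 1 ^ m)  ≤⟨ binomial-term≤ 1 1 p m ⟩
  2 ^ (p + m)                    ∎
  where open ≤-Reasoning

C*4^≤5^ : ∀ a g → ((a + g) C a) * 4 ^ a ≤ 5 ^ (a + g)
C*4^≤5^ a g = begin
  ((a + g) C a) * 4 ^ a          ≡⟨ cong (((a + g) C a) *_) (sym (trans (cong (4 ^ a *_) (^-zeroˡ g)) (*-identityʳ _))) ⟩
  ((a + g) C a) * (4 ^ a * 1 ^ g) ≤⟨ binomial-term≤ 4 1 a g ⟩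
  5 ^ (a + g)                   ∎
  where open ≤-Reasoning

absorption : ∀ n k → suc k * (suc n C suc k) ≡ suc n * (n C k)
absorption zero    zero    = refl
absorption zero    (suc k) = *-zeroʳ (suc (suc k))
absorption (suc n) zero    = trans (*-identityˡ _) (trans (nC1≡n (suc (suc n))) (cong suc (sym (*-identityʳ (suc n)))))
absorption (suc n) (suc k) = begin
  suc (suc k) * (suc (suc n) C suc (suc k))  ≡⟨ cong (suc (suc k) *_) (pascal (suc n) (suc k)) ⟩
  suc (suc k) * (X + Y)                      ≡⟨ regroup k X Y ⟩
  (suc k * X + X) + suc (suc k) * Y          ≡⟨ cong₂ _+_ (cong (_+ X) (absorption n k)) (absorption n (suc k)) ⟩
  (suc n * (n C k) + X) + suc n * (n C suc k) ≡⟨ collect n (n C k) (n C suc k) X ⟩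
  suc n * (n C k + n C suc k) + X            ≡⟨ cong (λ z → suc n * z + X) (sym (pascal n k)) ⟩
  suc n * X + X                              ≡⟨ +-comm (suc n * X) X ⟩
  suc (suc n) * X                            ∎
  where
  open ≡-Reasoning
  X Y : ℕ
  X = suc n C suc k
  Y = suc n C suc (suc k)
  regroup : ∀ k X Y → suc (suc k) * (X + Y) ≡ (suc k * X + X) + suc (suc k) * Y
  regroup = solve-∀
  collect : ∀ n x y X → (suc n * x + X) + suc n * y ≡ suc n * (x + y) + X
  collect = solve-∀

4^m≤[1+2m]*[2m]Cm : ∀ m → 4 ^ m ≤ suc (m + m) * ((m + m) C m)
4^m≤[1+2m]*[2m]Cm zero    = ≤-refl
4^m≤[1+2m]*[2m]Cm (suc m) = *-cancelˡ-≤ (suc m) (begin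
  suc m * (4 * 4 ^ m)                                  ≡⟨ rearrange m (4 ^ m) ⟩
  suc m * 4 * 4 ^ m                                    ≤⟨ *-monoˡ-≤ (4 ^ m) (grow m) ⟩
  2 * suc (suc (suc (m + m))) * 4 ^ m                  ≤⟨ *-monoʳ-≤ (2 * suc (suc (suc (m + m)))) (4^m≤[1+2m]*[2m]Cm m) ⟩
  2 * suc (suc (suc (m + m))) * (suc (m + m) * ((m + m) C m)) ≡⟨ cong (2 * suc (suc (suc (m + m))) *_) (sym (absorption (m + m) m)) ⟩
  2 * suc (suc (suc (m + m))) * (suc m * X)            ≡⟨ swap m X ⟩
  suc m * (suc (suc m + suc m) * (X + X))              ≡⟨ cong (λ z → suc m * (suc (suc m + suc m) * z)) (sym central≡2X) ⟩
  suc m * (suc (suc m + suc m) * ((suc m + suc m) C suc m)) ∎)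
  where
  open ≤-Reasoning
  X : ℕ
  X = suc (m + m) C suc m
  central≡2X : (suc m + suc m) C suc m ≡ X + X
  central≡2X = begin-equality
    suc (m + suc m) C suc m              ≡⟨ cong (λ z → suc z C suc m) (+-suc m m) ⟩
    suc (suc (m + m)) C suc m            ≡⟨ pascal (suc (m + m)) m ⟩
    suc (m + m) C m + X                  ≡⟨ cong (λ z → z C m + X) (sym (+-suc m m)) ⟩
    (m + suc m) C m + X                  ≡⟨ cong (_+ X) (C-sym m (suc m)) ⟩
    X + X                                ∎
  rearrange : ∀ m x → suc m * (4 * x) ≡ suc m * 4 * x
  rearrange = solve-∀
  grow : ∀ m → suc m * 4 ≤ 2 * suc (suc (suc (m + m)))
  grow m = ≤-trans (≤-reflexive (e m)) (*-monoʳ-≤ 2 (n≤1+n (suc (suc (m + m)))))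
    where
    e : ∀ m → suc m * 4 ≡ 2 * suc (suc (m + m))
    e = solve-∀
  swap : ∀ m X → 2 * suc (suc (suc (m + m))) * (suc m * X) ≡ suc m * (suc (suc m + suc m) * (X + X))
  swap = solve-∀

data EvenOdd : ℕ → Set where
  even : ∀ m → EvenOdd (m + m)
  odd  : ∀ m → EvenOdd (suc (m + m))

evenOdd : ∀ n → EvenOdd n
evenOdd zero    = even 0
evenOdd (suc n) with evenOdd n
... | even m = odd m
... | odd m  = subst EvenOdd (cong suc (+-suc m m)) (even (suc m))

4^m≡2^[m+m] : ∀ m → 4 ^ m ≡ 2 ^ (m + m)
4^m≡2^[m+m] m = trans (^-*-assoc 2 2 m) (cong (λ z → 2 ^ (m + z)) (+-identityʳ m))

central-binomial : ∀ f → 2 ^ f ≤ suc f * (f C ⌈ f /2⌉)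
central-binomial f with evenOdd f
... | even m rewrite sym (n≡⌈n+n/2⌉ m) | sym (4^m≡2^[m+m] m) = 4^m≤[1+2m]*[2m]Cm m
... | odd m  rewrite sym (n≡⌊n+n/2⌋ m) | sym (4^m≡2^[m+m] m) = begin
  2 * 4 ^ m                                 ≤⟨ *-monoʳ-≤ 2 (4^m≤[1+2m]*[2m]Cm m) ⟩
  2 * (suc (m + m) * ((m + m) C m))         ≡⟨ cong (2 *_) (sym (absorption (m + m) m)) ⟩
  2 * (suc m * (suc (m + m) C suc m))       ≡⟨ double m (suc (m + m) C suc m) ⟩
  suc (suc (m + m)) * (suc (m + m) C suc m) ∎
  where
  open ≤-Reasoning
  double : ∀ m x → 2 * (suc m * x) ≡ suc (suc (m + m)) * x
  double = solve-∀

⌊n/2⌋+⌊n/2⌋≤n : ∀ n → ⌊ n /2⌋ + ⌊ n /2⌋ ≤ n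
⌊n/2⌋+⌊n/2⌋≤n zero          = z≤n
⌊n/2⌋+⌊n/2⌋≤n (suc zero)    = z≤n
⌊n/2⌋+⌊n/2⌋≤n (suc (suc n)) = s≤s (≤-trans (≤-reflexive (+-suc _ _)) (s≤s (⌊n/2⌋+⌊n/2⌋≤n n)))

⌈n/2⌉+⌈n/2⌉≤1+n : ∀ n → ⌈ n /2⌉ + ⌈ n /2⌉ ≤ suc n
⌈n/2⌉+⌈n/2⌉≤1+n n = ⌊n/2⌋+⌊n/2⌋≤n (suc n)

4^≤2^ : ∀ g {f} → g + g ≤ f → 4 ^ g ≤ 2 ^ f
4^≤2^ g g+g≤f = ≤-trans (≤-reflexive (4^m≡2^[m+m] g)) (^-monoʳ-≤ 2 g+g≤f)

^-distribʳ-* : ∀ m n k → (m * n) ^ k ≡ m ^ k * n ^ k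
^-distribʳ-* m n zero    = refl
^-distribʳ-* m n (suc k) = trans (cong (m * n *_) (^-distribʳ-* m n k)) (*-interchange m n (m ^ k) (n ^ k))

bernoulli : ∀ x n → x ^ n * (x + n) ≤ x * suc x ^ n
bernoulli x zero    = ≤-reflexive (trans (*-identityˡ _) (trans (+-identityʳ x) (sym (*-identityʳ x))))
bernoulli x (suc n) = begin
  x * x ^ n * (x + suc n)               ≡⟨ expand x (x ^ n) n ⟩
  x * (x ^ n * (x + n)) + x * x ^ n     ≤⟨ +-mono-≤ (*-monoʳ-≤ x (bernoulli x n)) (*-monoʳ-≤ x (^-monoˡ-≤ n (n≤1+n x))) ⟩
  x * (x * suc x ^ n) + x * suc x ^ n   ≡⟨ collect x (suc x ^ n) ⟩
  x * (suc x * suc x ^ n)               ∎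
  where
  open ≤-Reasoning
  expand : ∀ x y n → x * y * (x + suc n) ≡ x * (y * (x + n)) + x * y
  expand = solve-∀
  collect : ∀ x z → x * (x * z) + x * z ≡ x * (suc x * z)
  collect = solve-∀

2*p^[1+p]≤[1+p]^[1+p] : ∀ p → 2 * p ^ suc p ≤ suc p ^ suc p
2*p^[1+p]≤[1+p]^[1+p] zero        = z≤n
2*p^[1+p]≤[1+p]^[1+p] p@(suc p-1) = *-cancelˡ-≤ p (begin
  p * (2 * p ^ suc p)        ≤⟨ m≤m+n _ _ ⟩
  p * (2 * p ^ suc p) + p ^ suc p ≡⟨ regroup p (p ^ suc p) ⟩
  p ^ suc p * (p + suc p)    ≤⟨ bernoulli p (suc p) ⟩
  p * suc p ^ suc p          ∎)
  where
  open ≤-Reasoning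
  regroup : ∀ p y → p * (2 * y) + y ≡ y * (p + suc p)
  regroup = solve-∀

2^n*4^n≤9^n : ∀ n → 2 ^ n * 4 ^ n ≤ 9 ^ n
2^n*4^n≤9^n n = ≤-trans (≤-reflexive (sym (^-distribʳ-* 2 4 n))) (^-monoˡ-≤ n (n≤1+n 8))

poly-bound : ∀ k → suc k * suc k * (suc (k + k) * (6 * suc k)) ≤ (k + 2) ^ 8
poly-bound k = begin
  suc k * suc k * (suc (k + k) * (6 * suc k)) ≤⟨ *-mono-≤ (*-mono-≤ 1+k≤K 1+k≤K) (*-mono-≤ 1+2k≤2K (*-monoʳ-≤ 6 1+k≤K)) ⟩
  K * K * (2 * K * (6 * K))                   ≡⟨ regroup K ⟩
  12 * K ^ 4                                  ≤⟨ *-monoˡ-≤ (K ^ 4) (≤-trans (m≤m+n 12 4) (^-monoˡ-≤ 4 (m≤n+m 2 k))) ⟩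
  K ^ 4 * K ^ 4                               ≡⟨ sym (^-distribˡ-+-* K 4 4) ⟩
  K ^ 8                                       ∎
  where
  open ≤-Reasoning
  K : ℕ
  K = k + 2
  1+k≤K : suc k ≤ K
  1+k≤K = ≤-trans (n≤1+n (suc k)) (≤-reflexive (+-comm 2 k))
  1+2k≤2K : suc (k + k) ≤ 2 * K
  1+2k≤2K = ≤-trans (m≤m+n (suc (k + k)) 3) (≤-reflexive (e k))
    where
    e : ∀ k → suc (k + k) + 3 ≡ 2 * (k + 2)
    e = solve-∀
  regroup : ∀ x → x * x * (2 * x * (6 * x)) ≡ 12 * (x * (x * (x * (x * 1))))
  regroup = solve-∀

-- The left side is 4 ^ g times the term of index (a, g, v) of the trinomial expansion of (4 + 1 + 4) ^ (a + g + v).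
trinomial-bound : ∀ a g v → (((a + g) + v) C (a + g)) * ((a + g) C a) * 4 ^ ((a + g) + v) ≤ 9 ^ ((a + g) + v) * 4 ^ g
trinomial-bound a g v = begin
  N * Cᵤ * 4 ^ (u + v)              ≡⟨ cong (N * Cᵤ *_) (trans (^-distribˡ-+-* 4 u v) (cong (_* 4 ^ v) (^-distribˡ-+-* 4 a g))) ⟩
  N * Cᵤ * (4 ^ a * 4 ^ g * 4 ^ v)  ≡⟨ regroup N Cᵤ (4 ^ a) (4 ^ g) (4 ^ v) ⟩
  N * (Cᵤ * 4 ^ a) * 4 ^ v * 4 ^ g  ≤⟨ *-monoˡ-≤ (4 ^ g) (*-monoˡ-≤ (4 ^ v) (*-monoʳ-≤ N (C*4^≤5^ a g))) ⟩
  N * 5 ^ u * 4 ^ v * 4 ^ g        ≡⟨ cong (_* 4 ^ g) (*-assoc N (5 ^ u) (4 ^ v)) ⟩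
  N * (5 ^ u * 4 ^ v) * 4 ^ g      ≤⟨ *-monoˡ-≤ (4 ^ g) (binomial-term≤ 5 4 u v) ⟩
  9 ^ (u + v) * 4 ^ g              ∎
  where
  open ≤-Reasoning
  u N Cᵤ : ℕ
  u = a + g
  N = (u + v) C u
  Cᵤ = u C a
  regroup : ∀ n m x y z → n * m * (x * y * z) ≡ n * (m * x) * z * y
  regroup = solve-∀

-- Used with q ≈ N / c, the greedy multiplier, and c ≥ 2 ^ f / (f + 1), a central binomial coefficient.
ratio-bound : ∀ q c N f {x y} → 2 ^ f ≤ suc f * c → q * c ≤ N + c →
              N * x ≤ 2 * 2 ^ f * y → c * x ≤ 2 ^ f * y → q * x ≤ 3 * suc f * y
ratio-bound q c N f {x} {y} central qc≤N+c Nx≤ cx≤ =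
  *-cancelˡ-≤ (2 ^ f) {{m^n≢0 2 f}} (begin
    2 ^ f * (q * x)                ≤⟨ *-monoˡ-≤ (q * x) central ⟩
    suc f * c * (q * x)            ≡⟨ regroup (suc f) c q x ⟩
    suc f * (q * c * x)            ≤⟨ *-monoʳ-≤ (suc f) (*-monoˡ-≤ x qc≤N+c) ⟩
    suc f * ((N + c) * x)          ≡⟨ cong (suc f *_) (*-distribʳ-+ x N c) ⟩
    suc f * (N * x + c * x)        ≤⟨ *-monoʳ-≤ (suc f) (+-mono-≤ Nx≤ cx≤) ⟩
    suc f * (2 * 2 ^ f * y + 2 ^ f * y) ≡⟨ collect (suc f) (2 ^ f) y ⟩
    2 ^ f * (3 * suc f * y)        ∎)
  where
  open ≤-Reasoning
  regroup : ∀ s c q x → s * c * (q * x) ≡ s * (q * c * x)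
  regroup = solve-∀
  collect : ∀ s t y → s * (2 * t * y + t * y) ≡ t * (3 * s * y)
  collect = solve-∀

class-cost-bound : ∀ a g b g′ q {f k} → g + g′ ≡ f → (a + g) + (b + g′) ≡ k →
  2 ^ f ≤ suc f * (f C g) → g + g ≤ suc f → g′ + g′ ≤ f →
  q * (f C g) ≤ (k C (a + g)) + (f C g) →
  q * ((((a + g) C a) + ((b + g′) C b)) * 4 ^ k) ≤ 6 * suc f * 9 ^ k
class-cost-bound a g b g′ q refl refl central g+g≤1+f g′+g′≤f qc≤N+c = begin
  q * ((Cᵤ + Cᵥ) * 4 ^ k)                  ≡⟨ distrib q Cᵤ Cᵥ (4 ^ k) ⟩
  q * (Cᵤ * 4 ^ k) + q * (Cᵥ * 4 ^ k)      ≤⟨ +-mono-≤ (side Cᵤ N*Cᵤ*4^k≤ Cᵤ≤2^k) (side Cᵥ N*Cᵥ*4^k≤ Cᵥ≤2^k) ⟩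
  3 * suc f * 9 ^ k + 3 * suc f * 9 ^ k    ≡⟨ collect (suc f) (9 ^ k) ⟩
  6 * suc f * 9 ^ k                        ∎
  where
  open ≤-Reasoning
  u v f k c N Cᵤ Cᵥ : ℕ
  u = a + g
  v = b + g′
  f = g + g′
  k = u + v
  c = f C g
  N = k C u
  Cᵤ = u C a
  Cᵥ = v C b
  distrib : ∀ q x y z → q * ((x + y) * z) ≡ q * (x * z) + q * (y * z)
  distrib = solve-∀
  collect : ∀ s x → 3 * s * x + 3 * s * x ≡ 6 * s * x
  collect = solve-∀
  Cᵤ≤2^k : Cᵤ ≤ 2 ^ k
  Cᵤ≤2^k = ≤-trans (C≤2^ a g) (^-monoʳ-≤ 2 (m≤m+n u v))
  Cᵥ≤2^k : Cᵥ ≤ 2 ^ k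
  Cᵥ≤2^k = ≤-trans (C≤2^ b g′) (^-monoʳ-≤ 2 (m≤n+m v u))
  side : ∀ X → N * (X * 4 ^ k) ≤ 2 * 2 ^ f * 9 ^ k → X ≤ 2 ^ k → q * (X * 4 ^ k) ≤ 3 * suc f * 9 ^ k
  side X N*X*4^k≤ X≤2^k = ratio-bound q c N f central qc≤N+c N*X*4^k≤ (begin
    c * (X * 4 ^ k)          ≤⟨ *-mono-≤ (C≤2^ g g′) (*-monoˡ-≤ (4 ^ k) X≤2^k) ⟩
    2 ^ f * (2 ^ k * 4 ^ k)  ≤⟨ *-monoʳ-≤ (2 ^ f) (2^n*4^n≤9^n k) ⟩
    2 ^ f * 9 ^ k            ∎)
  N*Cᵤ*4^k≤ : N * (Cᵤ * 4 ^ k) ≤ 2 * 2 ^ f * 9 ^ k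
  N*Cᵤ*4^k≤ = begin
    N * (Cᵤ * 4 ^ k)   ≡⟨ sym (*-assoc N Cᵤ (4 ^ k)) ⟩
    N * Cᵤ * 4 ^ k     ≤⟨ trinomial-bound a g v ⟩
    9 ^ k * 4 ^ g      ≤⟨ *-monoʳ-≤ (9 ^ k) (4^≤2^ g g+g≤1+f) ⟩
    9 ^ k * 2 ^ suc f  ≡⟨ *-comm (9 ^ k) (2 ^ suc f) ⟩
    2 * 2 ^ f * 9 ^ k  ∎
  N*Cᵥ*4^k≤ : N * (Cᵥ * 4 ^ k) ≤ 2 * 2 ^ f * 9 ^ k
  N*Cᵥ*4^k≤ = begin
    N * (Cᵥ * 4 ^ k)                   ≡⟨ sym (*-assoc N Cᵥ (4 ^ k)) ⟩
    N * Cᵥ * 4 ^ k                     ≡⟨ cong₂ (λ x y → x * Cᵥ * 4 ^ y) (C-sym u v) (+-comm u v) ⟩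
    ((v + u) C v) * Cᵥ * 4 ^ (v + u)   ≤⟨ trinomial-bound b g′ u ⟩
    9 ^ (v + u) * 4 ^ g′               ≤⟨ *-mono-≤ (≤-reflexive (cong (9 ^_) (+-comm v u))) (4^≤2^ g′ g′+g′≤f) ⟩
    9 ^ k * 2 ^ f                      ≤⟨ *-monoʳ-≤ (9 ^ k) (m≤n*m (2 ^ f) 2) ⟩
    9 ^ k * (2 * 2 ^ f)                ≡⟨ *-comm (9 ^ k) _ ⟩
    2 * 2 ^ f * 9 ^ k                  ∎

-- Sums and counts over lists

∑ : List A → (A → ℕ) → ℕ
∑ xs f = sum (map f xs)

𝟙 : Bool → ℕ
𝟙 b = if b then 1 else 0

count : (A → Bool) → List A → ℕ
count p xs = ∑ xs (𝟙 ∘ p)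

∑-zero : ∀ (xs : List A) → ∑ xs (λ _ → 0) ≡ 0
∑-zero []       = refl
∑-zero (x ∷ xs) = ∑-zero xs

∑-++ : ∀ (xs ys : List A) (f : A → ℕ) → ∑ (xs ++ ys) f ≡ ∑ xs f + ∑ ys f
∑-++ xs ys f = trans (cong sum (map-++ f xs ys)) (sum-++ (map f xs) (map f ys))

∑-map : ∀ (g : A → B) xs (f : B → ℕ) → ∑ (map g xs) f ≡ ∑ xs (f ∘ g)
∑-map g xs f = cong sum (sym (map-∘ xs))

∑-cong : ∀ (xs : List A) {f g} → (∀ x → f x ≡ g x) → ∑ xs f ≡ ∑ xs g
∑-cong xs f≗g = cong sum (map-cong f≗g xs)

∑-+ : ∀ (xs : List A) (f g : A → ℕ) → ∑ xs (λ x → f x + g x) ≡ ∑ xs f + ∑ xs g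
∑-+ []       f g = refl
∑-+ (x ∷ xs) f g = trans (cong (f x + g x +_) (∑-+ xs f g)) (+-interchange (f x) (g x) (∑ xs f) (∑ xs g))

∑-*ˡ : ∀ (xs : List A) q (f : A → ℕ) → ∑ xs (λ x → q * f x) ≡ q * ∑ xs f
∑-*ˡ []       q f = sym (*-zeroʳ q)
∑-*ˡ (x ∷ xs) q f = trans (cong (q * f x +_) (∑-*ˡ xs q f)) (sym (*-distribˡ-+ q (f x) (∑ xs f)))

∑-*ʳ : ∀ (xs : List A) (f : A → ℕ) q → ∑ xs f * q ≡ ∑ xs (λ x → f x * q)
∑-*ʳ xs f q = trans (*-comm (∑ xs f) q) (trans (sym (∑-*ˡ xs q f)) (∑-cong xs (λ x → *-comm q (f x))))

∑-comm : ∀ (xs : List A) (ys : List B) (f : A → B → ℕ) → ∑ xs (λ x → ∑ ys (f x)) ≡ ∑ ys (λ y → ∑ xs (λ x → f x y))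
∑-comm []       ys f = sym (∑-zero ys)
∑-comm (x ∷ xs) ys f = trans (cong (∑ ys (f x) +_) (∑-comm xs ys f)) (sym (∑-+ ys (f x) (λ y → ∑ xs (λ x′ → f x′ y))))

∑-concatMap : ∀ (h : A → List B) xs (f : B → ℕ) → ∑ (concatMap h xs) f ≡ ∑ xs (λ x → ∑ (h x) f)
∑-concatMap h []       f = refl
∑-concatMap h (x ∷ xs) f = trans (∑-++ (h x) (concatMap h xs) f) (cong (∑ (h x) f +_) (∑-concatMap h xs f))

∑≤length* : ∀ (xs : List A) {f d} → (∀ {x} → x ∈ xs → f x ≤ d) → ∑ xs f ≤ length xs * d
∑≤length* []       f≤d = z≤n
∑≤length* (x ∷ xs) f≤d = +-mono-≤ (f≤d (here refl)) (∑≤length* xs (f≤d ∘ there))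

length*≤∑ : ∀ (xs : List A) {f d} → (∀ {x} → x ∈ xs → d ≤ f x) → length xs * d ≤ ∑ xs f
length*≤∑ []       d≤f = z≤n
length*≤∑ (x ∷ xs) d≤f = +-mono-≤ (d≤f (here refl)) (length*≤∑ xs (d≤f ∘ there))

pigeonhole : ∀ (xs : List A) {f m} → length xs * m < ∑ xs f → ∃[ x ] x ∈ xs × m < f x
pigeonhole []       ()
pigeonhole (x ∷ xs) {f} {m} lt with m <? f x
... | yes m<fx = x , here refl , m<fx
... | no  m≮fx with pigeonhole xs (+-cancelˡ-< m _ _ (≤-trans lt (+-monoˡ-≤ _ (≮⇒≥ m≮fx))))
...   | y , y∈xs , m<fy = y , there y∈xs , m<fy

length-filterᵇ : ∀ (p : A → Bool) xs → length (filterᵇ p xs) ≡ count p xs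
length-filterᵇ p []       = refl
length-filterᵇ p (x ∷ xs) with p x
... | true  = cong suc (length-filterᵇ p xs)
... | false = length-filterᵇ p xs

count-filterᵇ : ∀ (p q : A → Bool) xs → count p (filterᵇ q xs) ≡ count (λ x → q x ∧ p x) xs
count-filterᵇ p q []       = refl
count-filterᵇ p q (x ∷ xs) with q x
... | true  = cong (𝟙 (p x) +_) (count-filterᵇ p q xs)
... | false = count-filterᵇ p q xs

count+length-filterᵇ-not : ∀ (p : A → Bool) xs → count p xs + length (filterᵇ (not ∘ p) xs) ≡ length xs
count+length-filterᵇ-not p []       = refl
count+length-filterᵇ-not p (x ∷ xs) with p x
... | true  = cong suc (count+length-filterᵇ-not p xs)
... | false = trans (+-suc _ _) (cong suc (count+length-filterᵇ-not p xs))

count-cong : ∀ {p q : A → Bool} xs → (∀ x → p x ≡ q x) → count p xs ≡ count q xs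
count-cong xs p≗q = ∑-cong xs (λ x → cong 𝟙 (p≗q x))

length-cartesianProduct : ∀ (xs : List A) (ys : List B) → length (cartesianProduct xs ys) ≡ length xs * length ys
length-cartesianProduct []       ys = refl
length-cartesianProduct (x ∷ xs) ys = trans (length-++ (map (x ,_) ys))
  (cong₂ _+_ (length-map (x ,_) ys) (length-cartesianProduct xs ys))

count-false : ∀ {p : A → Bool} xs → (∀ x → p x ≡ false) → count p xs ≡ 0
count-false xs p≗false = trans (count-cong xs p≗false) (∑-zero xs)

count-upTo-suc : ∀ (h : ℕ → Bool) n → count h (upTo (suc n)) ≡ count h (upTo n) + 𝟙 (h n)
count-upTo-suc h n = begin
  count h (upTo (suc n))                          ≡⟨ cong (count h) (sym (upTo-∷ʳ n)) ⟩
  count h (upTo n ∷ʳ n)                           ≡⟨ ∑-++ (upTo n) [ n ] _ ⟩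
  count h (upTo n) + (𝟙 (h n) + 0) ≡⟨ cong (count h (upTo n) +_) (+-identityʳ _) ⟩
  count h (upTo n) + 𝟙 (h n)       ∎
  where open ≡-Reasoning

count-upTo-double : ∀ (h : ℕ → Bool) n →
  count h (upTo (n + n)) ≡ count (λ m → h (m + m)) (upTo n) + count (λ m → h (suc (m + m))) (upTo n)
count-upTo-double h zero    = refl
count-upTo-double h (suc n) = begin
  count h (upTo (suc n + suc n))                          ≡⟨ cong (count h ∘ upTo ∘ suc) (+-suc n n) ⟩
  count h (upTo (suc (suc (n + n))))                      ≡⟨ trans (count-upTo-suc h _) (cong (_+ 𝟙 (h (suc (n + n)))) (count-upTo-suc h _)) ⟩
  count h (upTo (n + n)) + 𝟙 (h (n + n)) + 𝟙 (h (suc (n + n))) ≡⟨ cong (λ z → z + 𝟙 (h (n + n)) + 𝟙 (h (suc (n + n)))) (count-upTo-double h n) ⟩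
  E + O + 𝟙 (h (n + n)) + 𝟙 (h (suc (n + n)))             ≡⟨ trans (+-assoc (E + O) _ _) (+-interchange E O _ _) ⟩
  (E + 𝟙 (h (n + n))) + (O + 𝟙 (h (suc (n + n))))          ≡⟨ sym (cong₂ _+_ (count-upTo-suc _ n) (count-upTo-suc _ n)) ⟩
  count (λ m → h (m + m)) (upTo (suc n)) + count (λ m → h (suc (m + m))) (upTo (suc n)) ∎
  where
  open ≡-Reasoning
  E O : ℕ
  E = count (λ m → h (m + m)) (upTo n)
  O = count (λ m → h (suc (m + m))) (upTo n)

∣tabulate∣≡count-upTo : ∀ n (h : ℕ → Bool) → ∣ tabulate {n = n} (h ∘ toℕ) ∣ ≡ count h (upTo n)
∣tabulate∣≡count-upTo zero    h = refl
∣tabulate∣≡count-upTo (suc n) h = trans (head+tail (h 0)) (cong (𝟙 (h 0) +_) tail≡)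
  where
  tail≡ : ∣ tabulate {n = n} (h ∘ suc ∘ toℕ) ∣ ≡ count h (applyUpTo suc n)
  tail≡ = trans (∣tabulate∣≡count-upTo n (h ∘ suc)) (trans (sym (∑-map suc (upTo n) _)) (cong (count h) (map-upTo suc n)))
  head+tail : ∀ b → ∣ b ∷ tabulate {n = n} (h ∘ suc ∘ toℕ) ∣ ≡ 𝟙 b + ∣ tabulate {n = n} (h ∘ suc ∘ toℕ) ∣
  head+tail true  = refl
  head+tail false = refl

-- Greedy set cover

module GreedyCover {X Y : Set} (covers : X → Y → Bool) (F : List X)
                   (c p : ℕ) .{{_ : NonZero c}} (|F|≤[1+p]c : length F ≤ suc p * c) where

  q : ℕ
  q = suc p

  degree : Y → ℕ
  degree y = count (λ x → covers x y) F

  Covered : List X → Y → Set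
  Covered S y = Any (λ x → T (covers x y)) S

  HighDegree : List Y → Set
  HighDegree W = ∀ {y} → y ∈ W → c ≤ degree y

  ∑-covered≡∑-degree : ∀ W → ∑ F (λ x → count (covers x) W) ≡ ∑ W degree
  ∑-covered≡∑-degree W = ∑-comm F W (λ x y → 𝟙 (covers x y))

  good-choice : ∀ y W → HighDegree (y ∷ W) → ∃[ x ] x ∈ F × length (y ∷ W) ≤ q * count (covers x) (y ∷ W)
  good-choice y W high = pigeonhole F (begin-strict
    length F * length W              ≤⟨ *-monoˡ-≤ (length W) |F|≤[1+p]c ⟩
    q * c * length W                 <⟨ m<n+m (q * c * length W) (>-nonZero⁻¹ (q * c) {{m*n≢0 q c}}) ⟩
    q * c + q * c * length W         ≡⟨ regroup q c (length W) ⟩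
    q * (length (y ∷ W) * c)         ≤⟨ *-monoʳ-≤ q (length*≤∑ (y ∷ W) high) ⟩
    q * ∑ (y ∷ W) degree             ≡⟨ cong (q *_) (sym (∑-covered≡∑-degree (y ∷ W))) ⟩
    q * ∑ F (λ x → count (covers x) (y ∷ W)) ≡⟨ sym (∑-*ˡ F q _) ⟩
    ∑ F (λ x → q * count (covers x) (y ∷ W)) ∎)
    where
    open ≤-Reasoning
    regroup : ∀ q c w → q * c + q * c * w ≡ q * (suc w * c)
    regroup = solve-∀

  record PartialCover (t : ℕ) (W : List Y) : Set where
    field
      chosen      : List X
      remaining   : List Y
      length≤     : length chosen ≤ t
      chosen⊆F    : All (_∈ F) chosen
      progress    : ∀ {y} → y ∈ W → y ∈ remaining ⊎ Covered chosen y
      shrinks     : q ^ t * length remaining ≤ p ^ t * length W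

  -- x covers k of the k + w′ points of W, at least a 1/(1 + p) fraction, and leaves w′ of them.
  shrink-step : ∀ {k w′} → k + w′ ≤ q * k → q * w′ ≤ p * (k + w′)
  shrink-step {k} {w′} k+w′≤qk = begin
    w′ + p * w′     ≤⟨ +-monoˡ-≤ (p * w′) (+-cancelˡ-≤ k w′ (p * k) k+w′≤qk) ⟩
    p * k + p * w′  ≡⟨ sym (*-distribˡ-+ p k w′) ⟩
    p * (k + w′)    ∎
    where open ≤-Reasoning

  partial-cover : ∀ t W → HighDegree W → PartialCover t W
  partial-cover zero    W       _    = record
    { chosen = [] ; remaining = W ; length≤ = z≤n ; chosen⊆F = []
    ; progress = inj₁ ; shrinks = ≤-refl }
  partial-cover (suc t) []      _    = record
    { chosen = [] ; remaining = [] ; length≤ = z≤n ; chosen⊆F = []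
    ; progress = λ () ; shrinks = ≤-reflexive (trans (*-zeroʳ (q ^ suc t)) (sym (*-zeroʳ (p ^ suc t)))) }
  partial-cover (suc t) (y ∷ W) high with good-choice y W high
  ... | x , x∈F , good = record
    { chosen = x ∷ chosen ; remaining = remaining ; length≤ = s≤s length≤ ; chosen⊆F = x∈F ∷ chosen⊆F
    ; progress = progress′ ; shrinks = shrinks′ }
    where
    W′ : List Y
    W′ = filterᵇ (not ∘ covers x) (y ∷ W)
    open PartialCover (partial-cover t W′ (high ∘ proj₁ ∘ ∈-filter⁻ (T? ∘ (not ∘ covers x))))
    progress′ : ∀ {z} → z ∈ y ∷ W → z ∈ remaining ⊎ Covered (x ∷ chosen) z
    progress′ {z} z∈W with covers x z in eq
    ... | true  = inj₂ (here (Equivalence.from T-≡ eq))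
    ... | false with progress (∈-filter⁺ (T? ∘ (not ∘ covers x)) z∈W (Equivalence.from T-not-≡ eq))
    ...   | inj₁ z∈rem = inj₁ z∈rem
    ...   | inj₂ cov   = inj₂ (there cov)
    split : count (covers x) (y ∷ W) + length W′ ≡ length (y ∷ W)
    split = count+length-filterᵇ-not (covers x) (y ∷ W)
    shrinks′ : q ^ suc t * length remaining ≤ p ^ suc t * length (y ∷ W)
    shrinks′ = begin
      q * q ^ t * length remaining   ≡⟨ *-assoc q (q ^ t) _ ⟩
      q * (q ^ t * length remaining) ≤⟨ *-monoʳ-≤ q shrinks ⟩
      q * (p ^ t * length W′)        ≡⟨ x∙yz≈y∙xz q (p ^ t) _ ⟩
      p ^ t * (q * length W′)        ≤⟨ *-monoʳ-≤ (p ^ t) (shrink-step (≤-trans (≤-reflexive split) good)) ⟩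
      p ^ t * (p * (count (covers x) (y ∷ W) + length W′)) ≡⟨ cong (λ z → p ^ t * (p * z)) split ⟩
      p ^ t * (p * length (y ∷ W))   ≡⟨ sym (x∙yz≈y∙xz p (p ^ t) _) ⟩
      p * (p ^ t * length (y ∷ W))   ≡⟨ sym (*-assoc p (p ^ t) _) ⟩
      p * p ^ t * length (y ∷ W)     ∎
      where open ≤-Reasoning

  p^[qL]*2^L≤q^[qL] : ∀ L → p ^ (q * L) * 2 ^ L ≤ q ^ (q * L)
  p^[qL]*2^L≤q^[qL] L = begin
    p ^ (q * L) * 2 ^ L   ≡⟨ cong (_* 2 ^ L) (sym (^-*-assoc p q L)) ⟩
    (p ^ q) ^ L * 2 ^ L   ≡⟨ *-comm ((p ^ q) ^ L) _ ⟩
    2 ^ L * (p ^ q) ^ L   ≡⟨ sym (^-distribʳ-* 2 (p ^ q) L) ⟩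
    (2 * p ^ q) ^ L       ≤⟨ ^-monoˡ-≤ L (2*p^[1+p]≤[1+p]^[1+p] p) ⟩
    (q ^ q) ^ L           ≡⟨ ^-*-assoc q q L ⟩
    q ^ (q * L)           ∎
    where open ≤-Reasoning

  greedy-cover : ∀ L W → HighDegree W → length W < 2 ^ L →
                 ∃[ S ] length S ≤ q * L × All (_∈ F) S × (∀ {y} → y ∈ W → Covered S y)
  greedy-cover L W high |W|<2^L = chosen , length≤ , chosen⊆F , covered
    where
    open PartialCover (partial-cover (q * L) W high)
    t : ℕ
    t = q * L
    p^t*|W|<q^t : p ^ t * length W < q ^ t
    p^t*|W|<q^t with p ^ t in eq
    ... | zero  = m^n>0 q t
    ... | suc a = begin-strict
      suc a * length W  <⟨ *-monoʳ-< (suc a) |W|<2^L ⟩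
      suc a * 2 ^ L     ≡⟨ cong (_* 2 ^ L) (sym eq) ⟩
      p ^ t * 2 ^ L     ≤⟨ p^[qL]*2^L≤q^[qL] L ⟩
      q ^ t             ∎
      where open ≤-Reasoning
    nothing-remains : 1 ≤ length remaining → ⊥
    nothing-remains 1≤|R| = <⇒≱ p^t*|W|<q^t (begin
      q ^ t                      ≡⟨ sym (*-identityʳ (q ^ t)) ⟩
      q ^ t * 1                  ≤⟨ *-monoʳ-≤ (q ^ t) 1≤|R| ⟩
      q ^ t * length remaining   ≤⟨ shrinks ⟩
      p ^ t * length W           ∎)
      where open ≤-Reasoning
    covered : ∀ {y} → y ∈ W → Covered chosen y
    covered y∈W with progress y∈W
    ... | inj₁ y∈remaining = ⊥-elim (nothing-remains (∈-length y∈remaining))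
    ... | inj₂ cov         = cov

-- Subsets of {0, …, k − 1}

infix 7 _⊆ᵇ_
_⊆ᵇ_ : ∀ {n} → Subset n → Subset n → Bool
p ⊆ᵇ q = does (p ⊆? q)

⊆ᵇ⇒⊆ : ∀ {n} (p q : Subset n) → T (p ⊆ᵇ q) → p ⊆ q
⊆ᵇ⇒⊆ p q h with p ⊆? q
... | yes p⊆q = p⊆q

⊆⇒⊆ᵇ : ∀ {n} (p q : Subset n) → p ⊆ q → T (p ⊆ᵇ q)
⊆⇒⊆ᵇ p q p⊆q = subst T (sym (dec-true (p ⊆? q) p⊆q)) _

⊆ᵇ-trans : ∀ {n} (p q r : Subset n) → T (p ⊆ᵇ q) → T (q ⊆ᵇ r) → T (p ⊆ᵇ r)
⊆ᵇ-trans p q r p⊆q q⊆r = ⊆⇒⊆ᵇ p r (⊆-trans (⊆ᵇ⇒⊆ p q p⊆q) (⊆ᵇ⇒⊆ q r q⊆r))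

⊆∁-sym : ∀ {n} (p q : Subset n) → T (p ⊆ᵇ ∁ q) → T (q ⊆ᵇ ∁ p)
⊆∁-sym []          []          _ = _
⊆∁-sym (false ∷ p) (false ∷ q) h = ⊆∁-sym p q h
⊆∁-sym (false ∷ p) (true  ∷ q) h = ⊆∁-sym p q h
⊆∁-sym (true  ∷ p) (false ∷ q) h = ⊆∁-sym p q h

∣p─q∣+∣q∣≡∣p∣ : ∀ {n} (p q : Subset n) → T (q ⊆ᵇ p) → ∣ p ─ q ∣ + ∣ q ∣ ≡ ∣ p ∣
∣p─q∣+∣q∣≡∣p∣ []          []          _ = refl
∣p─q∣+∣q∣≡∣p∣ (false ∷ p) (false ∷ q) h = ∣p─q∣+∣q∣≡∣p∣ p q h
∣p─q∣+∣q∣≡∣p∣ (true  ∷ p) (false ∷ q) h = cong suc (∣p─q∣+∣q∣≡∣p∣ p q h)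
∣p─q∣+∣q∣≡∣p∣ (true  ∷ p) (true  ∷ q) h = trans (+-suc _ _) (cong suc (∣p─q∣+∣q∣≡∣p∣ p q h))

∣∁p∣+∣p∣≡n : ∀ {n} (p : Subset n) → ∣ ∁ p ∣ + ∣ p ∣ ≡ n
∣∁p∣+∣p∣≡n p = trans (cong (_+ ∣ p ∣) (∣∁p∣≡n∸∣p∣ p)) (m∸n+n≡m (∣p∣≤n p))

∣p∣+∣q∣≤n : ∀ {n} (p q : Subset n) → T (p ⊆ᵇ ∁ q) → ∣ p ∣ + ∣ q ∣ ≤ n
∣p∣+∣q∣≤n p q p⊆∁q = ≤-trans (+-monoˡ-≤ ∣ q ∣ (p⊆q⇒∣p∣≤∣q∣ (⊆ᵇ⇒⊆ p (∁ q) p⊆∁q))) (≤-reflexive (∣∁p∣+∣p∣≡n q))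

-- Least significant bit first, whereas disjointᵇ scans from the most significant one.
bits : ∀ k → ℕ → Subset k
bits zero    i = []
bits (suc k) i = bit i 0 ∷ bits k (i / 2)

m+m≡m*2 : ∀ m → m + m ≡ m * 2
m+m≡m*2 = solve-∀

bits-even : ∀ k m → bits (suc k) (m + m) ≡ false ∷ bits k m
bits-even k m rewrite m+m≡m*2 m = cong₂ _∷_ (cong (_≡ᵇ 1) (m*n%n≡0 m 2)) (cong (bits k) (m*n/n≡m m 2))

bits-odd : ∀ k m → bits (suc k) (suc (m + m)) ≡ true ∷ bits k m
bits-odd k m rewrite m+m≡m*2 m = cong₂ _∷_ (cong (_≡ᵇ 1) ([m+kn]%n≡m%n 1 m 2)) (cong (bits k) [1+2m]/2≡m)
  where
  [1+2m]/2≡m : (1 + m * 2) / 2 ≡ m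
  [1+2m]/2≡m = trans (+-distrib-/ 1 (m * 2) (subst (λ r → 1 + r < 2) (sym (m*n%n≡0 m 2)) ≤-refl)) (m*n/n≡m m 2)

∷⊆ᵇ∷∁ : ∀ {n} x y (p q : Subset n) → (x ∷ p) ⊆ᵇ ∁ (y ∷ q) ≡ not (x ∧ y) ∧ p ⊆ᵇ ∁ q
∷⊆ᵇ∷∁ false y    p q = refl
∷⊆ᵇ∷∁ true  true  p q = refl
∷⊆ᵇ∷∁ true  false p q = refl

disjointᵇ-suc : ∀ k i j → disjointᵇ (suc k) i j ≡ not (bit i 0 ∧ bit j 0) ∧ disjointᵇ k (i / 2) (j / 2)
disjointᵇ-suc zero    i j = refl
disjointᵇ-suc (suc k) i j = trans (cong (not (bit i (suc k) ∧ bit j (suc k)) ∧_) (disjointᵇ-suc k i j))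
                                  (∧-x∙yz≈y∙xz (not (bit i (suc k) ∧ bit j (suc k))) (not (bit i 0 ∧ bit j 0)) _)

disjointᵇ≡bits⊆∁bits : ∀ k i j → disjointᵇ k i j ≡ bits k i ⊆ᵇ ∁ (bits k j)
disjointᵇ≡bits⊆∁bits zero    i j = refl
disjointᵇ≡bits⊆∁bits (suc k) i j = begin
  disjointᵇ (suc k) i j                                          ≡⟨ disjointᵇ-suc k i j ⟩
  not (bit i 0 ∧ bit j 0) ∧ disjointᵇ k (i / 2) (j / 2)          ≡⟨ cong (not (bit i 0 ∧ bit j 0) ∧_) (disjointᵇ≡bits⊆∁bits k (i / 2) (j / 2)) ⟩
  not (bit i 0 ∧ bit j 0) ∧ bits k (i / 2) ⊆ᵇ ∁ (bits k (j / 2)) ≡⟨ sym (∷⊆ᵇ∷∁ (bit i 0) (bit j 0) _ _) ⟩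
  bits (suc k) i ⊆ᵇ ∁ (bits (suc k) j)                           ∎
  where open ≡-Reasoning

allSubsets : ∀ k → List (Subset k)
allSubsets k = map (bits k) (upTo (2 ^ k))

length-allSubsets : ∀ k → length (allSubsets k) ≡ 2 ^ k
length-allSubsets k = trans (length-map (bits k) (upTo (2 ^ k))) (length-upTo (2 ^ k))

bits∈allSubsets : ∀ k {i} → i < 2 ^ k → bits k i ∈ allSubsets k
bits∈allSubsets k i<2^k = ∈-map⁺ (bits k) (∈-upTo⁺ i<2^k)

count-allSubsets-suc : ∀ k (P : Subset (suc k) → Bool) →
  count P (allSubsets (suc k)) ≡ count (P ∘ (false ∷_)) (allSubsets k) + count (P ∘ (true ∷_)) (allSubsets k)
count-allSubsets-suc k P = begin
  count P (allSubsets (suc k))                          ≡⟨ ∑-map (bits (suc k)) (upTo (2 ^ suc k)) _ ⟩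
  count (P ∘ bits (suc k)) (upTo (2 ^ suc k))           ≡⟨ cong (λ z → count (P ∘ bits (suc k)) (upTo (2 ^ k + z))) (+-identityʳ (2 ^ k)) ⟩
  count (P ∘ bits (suc k)) (upTo (2 ^ k + 2 ^ k))       ≡⟨ count-upTo-double (P ∘ bits (suc k)) (2 ^ k) ⟩
  count (λ m → P (bits (suc k) (m + m))) (upTo (2 ^ k))
    + count (λ m → P (bits (suc k) (suc (m + m)))) (upTo (2 ^ k))
      ≡⟨ cong₂ _+_ (count-cong (upTo (2 ^ k)) (cong P ∘ bits-even k)) (count-cong (upTo (2 ^ k)) (cong P ∘ bits-odd k)) ⟩
  count (P ∘ (false ∷_) ∘ bits k) (upTo (2 ^ k)) + count (P ∘ (true ∷_) ∘ bits k) (upTo (2 ^ k))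
      ≡⟨ sym (cong₂ _+_ (∑-map (bits k) (upTo (2 ^ k)) _) (∑-map (bits k) (upTo (2 ^ k)) _)) ⟩
  count (P ∘ (false ∷_)) (allSubsets k) + count (P ∘ (true ∷_)) (allSubsets k) ∎
  where open ≡-Reasoning

∣tabulate∣≡count-allSubsets : ∀ k (P : Subset k → Bool) →
  ∣ tabulate {n = 2 ^ k} (λ i → P (bits k (toℕ i))) ∣ ≡ count P (allSubsets k)
∣tabulate∣≡count-allSubsets k P =
  trans (∣tabulate∣≡count-upTo (2 ^ k) (P ∘ bits k)) (sym (∑-map (bits k) (upTo (2 ^ k)) _))

between : ∀ {k} → Subset k → Subset k → ℕ → Subset k → Bool
between lo hi r U = lo ⊆ᵇ U ∧ U ⊆ᵇ hi ∧ (∣ U ∣ ≡ᵇ r)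

count-interval : ∀ {k} (lo hi : Subset k) m → T (lo ⊆ᵇ hi) →
  count (between lo hi (∣ lo ∣ + m)) (allSubsets k) ≡ ∣ hi ─ lo ∣ C m
count-interval []          []          zero    _ = refl
count-interval []          []          (suc m) _ = refl
count-interval {suc k} (false ∷ lo) (false ∷ hi) m h =
  trans (count-allSubsets-suc k (between (false ∷ lo) (false ∷ hi) (∣ lo ∣ + m)))
        (trans (cong₂ _+_ (count-interval lo hi m h) (count-false (allSubsets k) (λ U → ∧-zeroʳ (lo ⊆ᵇ U))))
               (+-identityʳ _))
count-interval {suc k} (true ∷ lo)  (true ∷ hi)  m h =
  trans (count-allSubsets-suc k (between (true ∷ lo) (true ∷ hi) (suc ∣ lo ∣ + m)))
        (cong₂ _+_ (count-false (allSubsets k) (λ _ → refl)) (count-interval lo hi m h))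
count-interval {suc k} (false ∷ lo) (true ∷ hi)  zero h =
  trans (count-allSubsets-suc k (between (false ∷ lo) (true ∷ hi) (∣ lo ∣ + 0)))
        (cong₂ _+_ (count-interval lo hi zero h) (count-false (allSubsets k) too-large))
  where
  too-large : ∀ U → between (false ∷ lo) (true ∷ hi) (∣ lo ∣ + 0) (true ∷ U) ≡ false
  too-large U with lo ⊆? U
  ... | no  _    = refl
  ... | yes lo⊆U = trans (cong (U ⊆ᵇ hi ∧_) (dec-false (suc ∣ U ∣ ≟ ∣ lo ∣ + 0) rank≢)) (∧-zeroʳ _)
    where
    rank≢ : suc ∣ U ∣ ≢ ∣ lo ∣ + 0
    rank≢ eq = <⇒≢ (s≤s (p⊆q⇒∣p∣≤∣q∣ lo⊆U)) (trans (sym (+-identityʳ ∣ lo ∣)) (sym eq))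
count-interval {suc k} (false ∷ lo) (true ∷ hi)  (suc m) h = begin
  count P (allSubsets (suc k))                                   ≡⟨ count-allSubsets-suc k P ⟩
  count (P ∘ (false ∷_)) (allSubsets k) + count (P ∘ (true ∷_)) (allSubsets k)
    ≡⟨ cong (count (P ∘ (false ∷_)) (allSubsets k) +_) (count-cong (allSubsets k) one-less) ⟩
  count (P ∘ (false ∷_)) (allSubsets k) + count (between lo hi (∣ lo ∣ + m)) (allSubsets k)
    ≡⟨ cong₂ _+_ (count-interval lo hi (suc m) h) (count-interval lo hi m h) ⟩
  ∣ hi ─ lo ∣ C suc m + ∣ hi ─ lo ∣ C m                          ≡⟨ +-comm (∣ hi ─ lo ∣ C suc m) _ ⟩
  ∣ hi ─ lo ∣ C m + ∣ hi ─ lo ∣ C suc m                          ≡⟨ sym (pascal ∣ hi ─ lo ∣ m) ⟩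
  suc ∣ hi ─ lo ∣ C suc m                                         ∎
  where
  open ≡-Reasoning
  P : Subset (suc k) → Bool
  P = between (false ∷ lo) (true ∷ hi) (∣ lo ∣ + suc m)
  one-less : ∀ U → P (true ∷ U) ≡ between lo hi (∣ lo ∣ + m) U
  one-less U = cong (λ r → lo ⊆ᵇ U ∧ U ⊆ᵇ hi ∧ (suc ∣ U ∣ ≡ᵇ r)) (+-suc ∣ lo ∣ m)

count-subsets-of-size : ∀ {k} (A : Subset k) a → count (λ r → r ⊆ᵇ A ∧ (∣ r ∣ ≡ᵇ a)) (allSubsets k) ≡ ∣ A ∣ C a
count-subsets-of-size {k} A a = begin
  count (λ r → r ⊆ᵇ A ∧ (∣ r ∣ ≡ᵇ a)) (allSubsets k) ≡⟨ count-cong (allSubsets k) as-interval ⟩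
  count (between (∅ {k}) A (∣ (∅ {k}) ∣ + a)) (allSubsets k)    ≡⟨ count-interval (∅ {k}) A a (⊆⇒⊆ᵇ (∅ {k}) A ⊥⊆) ⟩
  ∣ A ─ (∅ {k}) ∣ C a                                      ≡⟨ cong (λ r → ∣ r ∣ C a) (p─⊥≡p A) ⟩
  ∣ A ∣ C a                                          ∎
  where
  open ≡-Reasoning
  as-interval : ∀ r → r ⊆ᵇ A ∧ (∣ r ∣ ≡ᵇ a) ≡ between (∅ {k}) A (∣ (∅ {k}) ∣ + a) r
  as-interval r = cong₂ (λ x s → x ∧ r ⊆ᵇ A ∧ (∣ r ∣ ≡ᵇ s)) (sym (dec-true ((∅ {k}) ⊆? r) ⊥⊆)) (cong (_+ a) (sym (∣⊥∣≡0 k)))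

count-of-size : ∀ k a → count (λ r → ∣ r ∣ ≡ᵇ a) (allSubsets k) ≡ k C a
count-of-size k a = begin
  count (λ r → ∣ r ∣ ≡ᵇ a) (allSubsets k)             ≡⟨ count-cong (allSubsets k) (λ r → cong (_∧ (∣ r ∣ ≡ᵇ a)) (sym (dec-true (r ⊆? ⊤ₛ {k}) ⊆⊤))) ⟩
  count (λ r → r ⊆ᵇ ⊤ₛ ∧ (∣ r ∣ ≡ᵇ a)) (allSubsets k) ≡⟨ count-subsets-of-size {k} ⊤ₛ a ⟩
  ∣ ⊤ₛ {k} ∣ C a                                      ≡⟨ cong (_C a) (∣⊤∣≡n k) ⟩
  k C a                                                ∎
  where open ≡-Reasoning

-- The cover of D (2 ^ k)

module Construction (k : ℕ) where

  index : Fin (2 ^ k) → Subset k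
  index i = bits k (toℕ i)

  ofSize : ℕ → Subset k → Subset k → Bool
  ofSize a A r = r ⊆ᵇ A ∧ (∣ r ∣ ≡ᵇ a)

  subsetsOfSize : ℕ → Subset k → Subset (2 ^ k)
  subsetsOfSize a A = tabulate (ofSize a A ∘ index)

  rect : ℕ → ℕ → Subset k → Rect (2 ^ k) (2 ^ k)
  rect a b U = subsetsOfSize a U , subsetsOfSize b (∁ U)

  ∣subsetsOfSize∣ : ∀ a A → ∣ subsetsOfSize a A ∣ ≡ ∣ A ∣ C a
  ∣subsetsOfSize∣ a A = trans (∣tabulate∣≡count-allSubsets k (ofSize a A)) (count-subsets-of-size A a)

  ∈subsetsOfSize⁺ : ∀ {a A} i → T (ofSize a A (index i)) → i ∈ₛ subsetsOfSize a A
  ∈subsetsOfSize⁺ i h = lookup⇒[]= i _ (trans (lookup∘tabulate _ i) (Equivalence.to T-≡ h))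

  ∈subsetsOfSize⁻ : ∀ {a A} i → i ∈ₛ subsetsOfSize a A → T (index i ⊆ᵇ A)
  ∈subsetsOfSize⁻ i i∈ =
    proj₁ (Equivalence.to T-∧ (Equivalence.from T-≡ (trans (sym (lookup∘tabulate _ i)) ([]=⇒lookup i∈))))

  rect-allOnes : ∀ a b U → AllOnes (D k) (rect a b U)
  rect-allOnes a b U i j i∈R j∈C = trans (disjointᵇ≡bits⊆∁bits k (toℕ i) (toℕ j)) (Equivalence.to T-≡
    (⊆ᵇ-trans (index i) U (∁ (index j)) (∈subsetsOfSize⁻ i i∈R) (⊆∁-sym (index j) U (∈subsetsOfSize⁻ j j∈C))))

  L : ℕ
  L = suc (k + k)

  pairs : List (Subset k × Subset k)
  pairs = cartesianProduct (allSubsets k) (allSubsets k)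

  module Class (a b : ℕ) (a+b≤k : a + b ≤ k) where

    f g g′ u v : ℕ
    f  = k ∸ (a + b)
    g  = ⌈ f /2⌉
    g′ = ⌊ f /2⌋
    u  = a + g
    v  = b + g′

    g+g′≡f : g + g′ ≡ f
    g+g′≡f = trans (+-comm g g′) (⌊n/2⌋+⌈n/2⌉≡n f)

    u+v≡k : u + v ≡ k
    u+v≡k = trans (+-interchange a g b g′) (trans (cong (a + b +_) g+g′≡f) (m+[n∸m]≡n a+b≤k))

    c N : ℕ
    c = f C g
    N = k C u

    instance
      c≢0 : NonZero c
      c≢0 = >-nonZero (subst (λ z → 1 ≤ z C g) g+g′≡f (C-pos g g′))

    F : List (Subset k)
    F = filterᵇ (λ U → ∣ U ∣ ≡ᵇ u) (allSubsets k)

    |F|≤[1+N/c]c : length F ≤ suc (N / c) * c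
    |F|≤[1+N/c]c = begin
      length F            ≡⟨ trans (length-filterᵇ _ (allSubsets k)) (count-of-size k u) ⟩
      N                   ≡⟨ m≡m%n+[m/n]*n N c ⟩
      N % c + N / c * c   ≤⟨ +-monoˡ-≤ (N / c * c) (<⇒≤ (m%n<n N c)) ⟩
      c + N / c * c       ∎
      where open ≤-Reasoning

    [1+N/c]c≤N+c : suc (N / c) * c ≤ N + c
    [1+N/c]c≤N+c = ≤-trans (+-monoʳ-≤ c (m/n*n≤m N c)) (≤-reflexive (+-comm c N))

    covers : Subset k → Subset k × Subset k → Bool
    covers U (r , s) = r ⊆ᵇ U ∧ U ⊆ᵇ ∁ s

    inClass : Subset k × Subset k → Bool
    inClass (r , s) = r ⊆ᵇ ∁ s ∧ (∣ r ∣ ≡ᵇ a) ∧ (∣ s ∣ ≡ᵇ b)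

    W : List (Subset k × Subset k)
    W = filterᵇ inClass pairs

    open GreedyCover covers F c (N / c) |F|≤[1+N/c]c

    degree≡c : ∀ r s → T (r ⊆ᵇ ∁ s) → ∣ r ∣ ≡ a → ∣ s ∣ ≡ b → degree (r , s) ≡ c
    degree≡c r s r⊆∁s refl refl = begin
      count (λ U → covers U (r , s)) F                               ≡⟨ count-filterᵇ _ _ (allSubsets k) ⟩
      count (λ U → (∣ U ∣ ≡ᵇ u) ∧ covers U (r , s)) (allSubsets k)  ≡⟨ count-cong (allSubsets k) reorder ⟩
      count (between r (∁ s) (∣ r ∣ + g)) (allSubsets k)              ≡⟨ count-interval r (∁ s) g r⊆∁s ⟩
      ∣ ∁ s ─ r ∣ C g                                                 ≡⟨ cong (_C g) ∣∁s─r∣≡f ⟩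
      c                                                                ∎
      where
      open ≡-Reasoning
      reorder : ∀ U → (∣ U ∣ ≡ᵇ u) ∧ covers U (r , s) ≡ between r (∁ s) (∣ r ∣ + g) U
      reorder U = trans (∧-comm (∣ U ∣ ≡ᵇ u) _) (∧-assoc (r ⊆ᵇ U) (U ⊆ᵇ ∁ s) _)
      ∣∁s─r∣≡f : ∣ ∁ s ─ r ∣ ≡ f
      ∣∁s─r∣≡f = begin
        ∣ ∁ s ─ r ∣                                 ≡⟨ sym (m+n∸n≡m _ (a + b)) ⟩
        (∣ ∁ s ─ r ∣ + (∣ r ∣ + ∣ s ∣)) ∸ (a + b)   ≡⟨ cong (_∸ (a + b)) (sym (+-assoc _ ∣ r ∣ ∣ s ∣)) ⟩
        (∣ ∁ s ─ r ∣ + ∣ r ∣ + ∣ s ∣) ∸ (a + b)     ≡⟨ cong (λ z → (z + ∣ s ∣) ∸ (a + b)) (∣p─q∣+∣q∣≡∣p∣ (∁ s) r r⊆∁s) ⟩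
        (∣ ∁ s ∣ + ∣ s ∣) ∸ (a + b)                 ≡⟨ cong (_∸ (a + b)) (∣∁p∣+∣p∣≡n s) ⟩
        f                                            ∎

    inClass⁻ : ∀ r s → T (inClass (r , s)) → T (r ⊆ᵇ ∁ s) × T (∣ r ∣ ≡ᵇ a) × T (∣ s ∣ ≡ᵇ b)
    inClass⁻ r s h with Equivalence.to (T-∧ {r ⊆ᵇ ∁ s}) h
    ... | r⊆∁s , sizes = r⊆∁s , Equivalence.to (T-∧ {∣ r ∣ ≡ᵇ a}) sizes

    high : HighDegree W
    high {r , s} y∈W with inClass⁻ r s (proj₂ (∈-filter⁻ (T? ∘ inClass) {xs = pairs} y∈W))
    ... | r⊆∁s , ∣r∣≡a , ∣s∣≡b =
      ≤-reflexive (sym (degree≡c r s r⊆∁s (≡ᵇ⇒≡ (∣ r ∣) a ∣r∣≡a) (≡ᵇ⇒≡ (∣ s ∣) b ∣s∣≡b)))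

    |W|<2^L : length W < 2 ^ L
    |W|<2^L = begin-strict
      length W                                         ≤⟨ length-filter (T? ∘ inClass) pairs ⟩
      length pairs                                     ≡⟨ length-cartesianProduct (allSubsets k) (allSubsets k) ⟩
      length (allSubsets k) * length (allSubsets k)    ≡⟨ cong₂ _*_ (length-allSubsets k) (length-allSubsets k) ⟩
      2 ^ k * 2 ^ k                                    ≡⟨ sym (^-distribˡ-+-* 2 k k) ⟩
      2 ^ (k + k)                                      <⟨ m<m+n (2 ^ (k + k)) (m^n>0 2 (k + k)) ⟩
      2 ^ (k + k) + 2 ^ (k + k)                        ≡⟨ cong (2 ^ (k + k) +_) (sym (+-identityʳ _)) ⟩
      2 ^ L                                            ∎
      where open ≤-Reasoning

    S : List (Subset k)
    S = proj₁ (greedy-cover L W high |W|<2^L)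

    rects : List (Rect (2 ^ k) (2 ^ k))
    rects = map (rect a b) S

    rectCost≡ : ∀ {U} → U ∈ F → rectCost (rect a b U) ≡ u C a + v C b
    rectCost≡ {U} U∈F = cong₂ _+_ (trans (∣subsetsOfSize∣ a U) (cong (_C a) ∣U∣≡u))
                                   (trans (∣subsetsOfSize∣ b (∁ U)) (cong (_C b) ∣∁U∣≡v))
      where
      ∣U∣≡u : ∣ U ∣ ≡ u
      ∣U∣≡u = ≡ᵇ⇒≡ ∣ U ∣ u (proj₂ (∈-filter⁻ (T? ∘ (λ U → ∣ U ∣ ≡ᵇ u)) {xs = allSubsets k} U∈F))
      ∣∁U∣≡v : ∣ ∁ U ∣ ≡ v
      ∣∁U∣≡v = +-cancelʳ-≡ u ∣ ∁ U ∣ v (trans (cong (∣ ∁ U ∣ +_) (sym ∣U∣≡u))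
                                         (trans (∣∁p∣+∣p∣≡n U) (trans (sym u+v≡k) (+-comm u v))))

    rects-cost : ∑ rects rectCost * 4 ^ k ≤ L * (6 * suc k * 9 ^ k)
    rects-cost = begin
      ∑ rects rectCost * 4 ^ k              ≡⟨ cong (_* 4 ^ k) (∑-map (rect a b) S rectCost) ⟩
      ∑ S (rectCost ∘ rect a b) * 4 ^ k     ≤⟨ *-monoˡ-≤ (4 ^ k) (∑≤length* S (≤-reflexive ∘ rectCost≡ ∘ All.lookup S⊆F)) ⟩
      length S * K * 4 ^ k                  ≤⟨ *-monoˡ-≤ (4 ^ k) (*-monoˡ-≤ K |S|≤qL) ⟩
      q * L * K * 4 ^ k                     ≡⟨ regroup q L K (4 ^ k) ⟩
      L * (q * (K * 4 ^ k))                 ≤⟨ *-monoʳ-≤ L (class-cost-bound a g b g′ q g+g′≡f u+v≡k (central-binomial f)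
                                                 (⌈n/2⌉+⌈n/2⌉≤1+n f) (⌊n/2⌋+⌊n/2⌋≤n f) [1+N/c]c≤N+c) ⟩
      L * (6 * suc f * 9 ^ k)               ≤⟨ *-monoʳ-≤ L (*-monoˡ-≤ (9 ^ k) (*-monoʳ-≤ 6 (s≤s (m∸n≤m k (a + b))))) ⟩
      L * (6 * suc k * 9 ^ k)               ∎
      where
      open ≤-Reasoning
      K : ℕ
      K = u C a + v C b
      |S|≤qL : length S ≤ q * L
      |S|≤qL = proj₁ (proj₂ (greedy-cover L W high |W|<2^L))
      S⊆F : All (_∈ F) S
      S⊆F = proj₁ (proj₂ (proj₂ (greedy-cover L W high |W|<2^L)))
      regroup : ∀ q L K x → q * L * K * x ≡ L * (q * (K * x))
      regroup = solve-∀

    rects-cover : ∀ i j → T (inClass (index i , index j)) → Any (InRect i j) rects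
    rects-cover i j h = Any.map⁺ (Any.map inRect (covered (∈-filter⁺ (T? ∘ inClass) y∈pairs h)))
      where
      covered : ∀ {y} → y ∈ W → Covered S y
      covered = proj₂ (proj₂ (proj₂ (greedy-cover L W high |W|<2^L)))
      y∈pairs : (index i , index j) ∈ pairs
      y∈pairs = ∈-cartesianProduct⁺ (bits∈allSubsets k (toℕ<n i)) (bits∈allSubsets k (toℕ<n j))
      inRect : ∀ {U} → T (covers U (index i , index j)) → InRect i j (rect a b U)
      inRect {U} cov with Equivalence.to (T-∧ {index i ⊆ᵇ U}) cov | inClass⁻ (index i) (index j) h
      ... | i⊆U , U⊆∁j | _ , ∣i∣≡a , ∣j∣≡b =
        ∈subsetsOfSize⁺ i (Equivalence.from T-∧ (i⊆U , ∣i∣≡a)) ,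
        ∈subsetsOfSize⁺ j (Equivalence.from T-∧ (⊆∁-sym U (index j) U⊆∁j , ∣j∣≡b))

  classRects : ℕ × ℕ → List (Rect (2 ^ k) (2 ^ k))
  classRects (a , b) with a + b ≤? k
  ... | yes a+b≤k = Class.rects a b a+b≤k
  ... | no  _     = []

  classRects-allOnes : ∀ ab → All (AllOnes (D k)) (classRects ab)
  classRects-allOnes (a , b) with a + b ≤? k
  ... | yes a+b≤k = All.map⁺ (All.universal (rect-allOnes a b) (Class.S a b a+b≤k))
  ... | no  _ = []

  classRects-cost : ∀ ab → ∑ (classRects ab) rectCost * 4 ^ k ≤ L * (6 * suc k * 9 ^ k)
  classRects-cost (a , b) with a + b ≤? k
  ... | yes a+b≤k = Class.rects-cost a b a+b≤k
  ... | no  _     = z≤n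

  D⇒disjoint : ∀ i j → D k i j ≡ true → T (index i ⊆ᵇ ∁ (index j))
  D⇒disjoint i j Dij = Equivalence.from T-≡ (trans (sym (disjointᵇ≡bits⊆∁bits k (toℕ i) (toℕ j))) Dij)

  classRects-cover : ∀ i j → D k i j ≡ true → Any (InRect i j) (classRects (∣ index i ∣ , ∣ index j ∣))
  classRects-cover i j Dij with ∣ index i ∣ + ∣ index j ∣ ≤? k
  ... | yes a+b≤k = Class.rects-cover _ _ a+b≤k i j (Equivalence.from T-∧ (D⇒disjoint i j Dij ,
                      Equivalence.from T-∧ (≡⇒≡ᵇ (∣ index i ∣) _ refl , ≡⇒≡ᵇ (∣ index j ∣) _ refl)))
  ... | no  a+b≰k = ⊥-elim (a+b≰k (∣p∣+∣q∣≤n (index i) (index j) (D⇒disjoint i j Dij)))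

  classes : List (ℕ × ℕ)
  classes = cartesianProduct (upTo (suc k)) (upTo (suc k))

  cover : Cover (D k)
  cover = record
    { rects   = concatMap classRects classes
    ; allOnes = All.concat⁺ (All.map⁺ {f = classRects} (All.universal classRects-allOnes classes))
    ; covers  = λ i j Dij → Any.concatMap⁺ classRects (lose (class∈classes i j) (classRects-cover i j Dij))
    }
    where
    class∈classes : ∀ i j → (∣ index i ∣ , ∣ index j ∣) ∈ classes
    class∈classes i j = ∈-cartesianProduct⁺ (∈-upTo⁺ (s≤s (∣p∣≤n (index i)))) (∈-upTo⁺ (s≤s (∣p∣≤n (index j))))

  cover-cost : coverCost cover * 4 ^ k ≤ 9 ^ k * (k + 2) ^ 8
  cover-cost = begin
    ∑ (concatMap classRects classes) rectCost * 4 ^ k              ≡⟨ cong (_* 4 ^ k) (∑-concatMap classRects classes rectCost) ⟩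
    ∑ classes (λ ab → ∑ (classRects ab) rectCost) * 4 ^ k          ≡⟨ ∑-*ʳ classes (λ ab → ∑ (classRects ab) rectCost) (4 ^ k) ⟩
    ∑ classes (λ ab → ∑ (classRects ab) rectCost * 4 ^ k)          ≤⟨ ∑≤length* classes (λ {ab} _ → classRects-cost ab) ⟩
    length classes * (L * (6 * suc k * 9 ^ k))                      ≡⟨ cong (_* (L * (6 * suc k * 9 ^ k))) |classes| ⟩
    suc k * suc k * (L * (6 * suc k * 9 ^ k))                       ≡⟨ regroup (suc k) L (9 ^ k) ⟩
    suc k * suc k * (L * (6 * suc k)) * 9 ^ k                       ≤⟨ *-monoˡ-≤ (9 ^ k) (poly-bound k) ⟩
    (k + 2) ^ 8 * 9 ^ k                                             ≡⟨ *-comm ((k + 2) ^ 8) (9 ^ k) ⟩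
    9 ^ k * (k + 2) ^ 8                                             ∎
    where
    open ≤-Reasoning
    |classes| : length classes ≡ suc k * suc k
    |classes| = trans (length-cartesianProduct (upTo (suc k)) (upTo (suc k))) (cong₂ _*_ (length-upTo (suc k)) (length-upTo (suc k)))
    regroup : ∀ s L x → s * s * (L * (6 * s * x)) ≡ s * s * (L * (6 * s)) * x
    regroup = solve-∀

theorem8 : ∃ λ (c : ℕ) → ∀ (k : ℕ) → OR₂-scaled≤ (D k) (4 ^ k) (9 ^ k * (k + 2) ^ c)
theorem8 = 8 , λ k → Construction.cover k , Construction.cover-cost k
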